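{- Let $\mathcal{G}=((V,E),\lambda)$ be a 1D-mobility temporal clique on $n\ge 2$ nodes, and let $\pi=v_1,\dots,v_n$ be an ordering of $V$ from which $\mathcal{R}(\mathcal{G})$ is a 1D-mobility schedule. Let $\mathcal{H}$ be the temporal subgraph of $\mathcal{G}$ consisting of the $2n-3$ edges (with their labels) incident to $v_1$ or to $v_n$. Then $\mathcal{H}$ is a temporal spanner of $\mathcal{G}$.
   Context: A temporal clique $\mathcal{G}=((V,E),\lambda)$ is a complete graph on $n$ nodes with each edge given a single label, labels pairwise distinct; its representation $\mathcal{R}(\mathcal{G})$ is the list of triples $(u,v,\lambda(uv))$ sorted by label. 1D-mobility model: agents lie on a line in an initial ordering $\pi$. A 1D-mobility schedule from $\pi$ is a sequence $x=(x_1,\dots,x_T)$ of pairs where, with $\pi_0=\pi$, each $x_t=\{u,v\}$ consists of two agents consecutive in $\pi_{t-1}$ and $\pi_t$ is obtained by exchanging them. $\mathcal{G}_{\pi,x}$ is the temporal graph with edge $uv$ at time $t$ whenever $x_t=uv$. A 1D-mobility temporal clique is a temporal clique isomorphic (label-preserving vertex bijection) to some $\mathcal{G}_{\pi,x}$. "$\mathcal{R}(\mathcal{G})$ is a 1D-mobility schedule from $\pi$" means the edges of $\mathcal{R}(\mathcal{G})$, read in increasing label order as crossings, form a valid 1D-mobility schedule from $\pi$. A temporal path from $u$ to $w$ is a sequence of edges $u=y_0y_1, y_1y_2,\dots,y_{k-1}y_k=w$ with strictly increasing labels. A temporal subgraph $\mathcal{H}$ of $\mathcal{G}$ (same vertex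 set, a subset of the labeled edges) is a temporal spanner if for every ordered pair of distinct vertices $(u,w)$ there is a temporal path from $u$ to $w$ in $\mathcal{H}$. -}

module Defs where

open import Data.Nat using (ℕ; zero; suc; _≤_; _<_)
open import Data.Fin using (Fin; toℕ; _≟_)
open import Data.Fin.Permutation using (Permutation′; _⟨$⟩ʳ_)
open import Data.Product using (Σ; ∃; _×_; _,_)
open import Data.Sum using (_⊎_)
open import Data.Empty using (⊥)
open import Data.List using (List; []; _∷_)
open import Data.List.Relation.Unary.Any using (Any)
open import Data.List.Relation.Unary.All using (All)
open import Data.List.Relation.Unary.Linked using (Linked)
open import Relation.Binary.PropositionalEquality using (_≡_; _≢_)
open import Relation.Nullary using (yes; no)

-- A (vertex) pair, read as an unordered pair {u,v}.
Pair : ℕ → Set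
Pair n = Fin n × Fin n

SamePair : ∀ {n} → Pair n → Pair n → Set
SamePair (a , b) (c , d) = (a ≡ c × b ≡ d) ⊎ (a ≡ d × b ≡ c)

record TemporalClique (n : ℕ) : Set where
  field
    lab : Fin n → Fin n → ℕ
    lab-sym : ∀ u v → lab u v ≡ lab v u
    lab-inj : ∀ u v u′ v′ → u ≢ v → u′ ≢ v′ →
              lab u v ≡ lab u′ v′ → SamePair (u , v) (u′ , v′)
open TemporalClique public

-- An ordering of agents: position ↦ agent (a function Fin n → Fin n).
-- Exchange the agents at positions i and j.
swapPos : ∀ {n} → Fin n → Fin n → Fin n → Fin n
swapPos i j k with k ≟ i
... | yes _ = j
... | no _ with k ≟ j
...   | yes _ = i
...   | no _ = k

-- 1D-mobility schedule from ordering σ (position ↦ agent): each pair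
-- consists of the two agents at consecutive positions i, i+1 of the
-- current ordering, which are then exchanged.
data Schedule {n : ℕ} : (Fin n → Fin n) → List (Pair n) → Set where
  done : ∀ {σ} → Schedule σ []
  cross : ∀ {σ p xs} (i j : Fin n) → toℕ j ≡ suc (toℕ i) →
          SamePair p (σ i , σ j) →
          Schedule (λ k → σ (swapPos i j k)) xs →
          Schedule σ (p ∷ xs)

-- xs is the representation R(G): the list of all edges of G sorted
-- increasingly by label (each entry a pair of distinct vertices, every
-- edge listed, labels strictly increasing along the list).
IsRepresentation : ∀ {n} → TemporalClique n → List (Pair n) → Set
IsRepresentation {n} G xs =
  All (λ p → Data.Product.proj₁ p ≢ Data.Product.proj₂ p) xs ×
  Linked (λ p q → lab G (Data.Product.proj₁ p) (Data.Product.proj₂ p)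
                  < lab G (Data.Product.proj₁ q) (Data.Product.proj₂ q)) xs ×
  (∀ u v → u ≢ v → Any (SamePair (u , v)) xs)

RepIsScheduleFrom : ∀ {n} → TemporalClique n → Permutation′ n → Set
RepIsScheduleFrom {n} G π =
  Σ (List (Pair n)) λ xs → IsRepresentation G xs × Schedule (π ⟨$⟩ʳ_) xs

-- x_t = {a,b}   (times start at 1)
At : ∀ {n} → List (Pair n) → ℕ → Pair n → Set
At [] t q = ⊥
At (p ∷ xs) zero q = ⊥
At (p ∷ xs) (suc zero) q = SamePair p q
At (p ∷ xs) (suc (suc t)) q = At xs (suc t) q

-- G is isomorphic (label-preserving vertex bijection f) to G_{π,x}:
-- uv has label t in G iff f u f v is an edge at time t in G_{π,x}.
IsoToMobility : ∀ {n} → TemporalClique n → Permutation′ n → List (Pair n) → Set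
IsoToMobility {n} G π x =
  Schedule (π ⟨$⟩ʳ_) x ×
  Σ (Permutation′ n) λ f → ∀ u v t →
    ((u ≢ v × lab G u v ≡ t) → At x t (f ⟨$⟩ʳ u , f ⟨$⟩ʳ v)) ×
    (At x t (f ⟨$⟩ʳ u , f ⟨$⟩ʳ v) → (u ≢ v × lab G u v ≡ t))

OneDMobilityClique : ∀ {n} → TemporalClique n → Set
OneDMobilityClique {n} G =
  Σ (Permutation′ n) λ π → Σ (List (Pair n)) λ x → IsoToMobility G π x

-- Temporal paths in the temporal subgraph with edge set E (edges carry
-- their labels from G): TPath G E b u w = temporal path from u to w
-- all of whose labels are ≥ b, labels strictly increasing.
data TPath {n : ℕ} (G : TemporalClique n) (E : Fin n → Fin n → Set)
     : ℕ → Fin n → Fin n → Set where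
  edge : ∀ {b u w} → u ≢ w → E u w → b ≤ lab G u w → TPath G E b u w
  step : ∀ {b u y w} → u ≢ y → E u y → b ≤ lab G u y →
         TPath G E (suc (lab G u y)) y w → TPath G E b u w

-- vertex v is v₁ (position 0) or vₙ (position n-1) of the ordering π
IsEndpoint : ∀ {n} → Permutation′ n → Fin n → Set
IsEndpoint {n} π v =
  ∃ λ (i : Fin n) → (toℕ i ≡ 0 ⊎ suc (toℕ i) ≡ n) × π ⟨$⟩ʳ i ≡ v

HEdge : ∀ {n} → Permutation′ n → Fin n → Fin n → Set
HEdge π u v = IsEndpoint π u ⊎ IsEndpoint π v

IsTemporalSpanner : ∀ {n} → TemporalClique n → (Fin n → Fin n → Set) → Set
IsTemporalSpanner {n} G E = ∀ (u w : Fin n) → u ≢ w → TPath G E 0 u w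

{-# OPTIONS --safe #-}
module Submission where

-- Let a and b be the agents at the two ends of π; every other agent x starts strictly between
-- them.  Agents a and b cross exactly once, and only when they are adjacent, so by then x has
-- crossed exactly one of them, and it crosses the other one afterwards: the label of ab lies
-- strictly between the labels of xa and xb.  Hence from any u a temporal path leaves through the
-- hub u meets first, crosses over ab to the other hub if necessary, and reaches w.

open import Defs
open import Data.Nat as ℕ using (ℕ; suc; z≤n; s≤s; _≤_)
open import Data.Nat.Properties as ℕ using ()
open import Data.Fin using (Fin; toℕ; _≟_; _<_; zero; fromℕ)
open import Data.Fin.Properties using (≤∧≢⇒<; <⇒≢; ≤fromℕ; <-trans; <-asym; <-irrefl; 0≢1+n; toℕ-fromℕ)
open import Data.Fin.Permutation using (Permutation′; _⟨$⟩ʳ_; _⟨$⟩ˡ_; inverseˡ; inverseʳ)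
open import Data.Product using (_×_; _,_; proj₁; proj₂)
open import Data.Sum as Sum using (_⊎_; inj₁; inj₂)
open import Data.Empty using (⊥)
open import Data.List using (List; _∷_)
open import Data.List.Relation.Unary.All using (All; lookupₛ)
open import Data.List.Relation.Unary.AllPairs using (AllPairs; _∷_)
open import Data.List.Relation.Unary.Any using (here; there; tail)
open import Data.List.Relation.Unary.Linked.Properties using (Linked⇒AllPairs)
import Data.List.Membership.Setoid as SetoidMembership
open import Function using (_∘_)
open import Function.Definitions using (StrictlyInverseˡ; StrictlyInverseʳ)
open import Level using (0ℓ)
open import Relation.Binary using (Setoid; IsEquivalence; Decidable)
open import Relation.Binary.PropositionalEquality using (_≡_; _≢_; refl; sym; trans; cong; subst; subst₂)
open import Relation.Nullary using (¬_; Dec; yes; no; contradiction)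
open import Relation.Nullary.Decidable using (_×-dec_; _⊎-dec_)

module _ {n : ℕ} where

  samePair-isEquivalence : IsEquivalence (SamePair {n})
  samePair-isEquivalence = record
    { refl  = inj₁ (refl , refl)
    ; sym   = λ { (inj₁ (refl , refl)) → inj₁ (refl , refl) ; (inj₂ (refl , refl)) → inj₂ (refl , refl) }
    ; trans = λ { (inj₁ (refl , refl)) s → s
                ; (inj₂ (refl , refl)) (inj₁ (refl , refl)) → inj₂ (refl , refl)
                ; (inj₂ (refl , refl)) (inj₂ (refl , refl)) → inj₁ (refl , refl) }
    }

  samePair? : Decidable (SamePair {n})
  samePair? (a , b) (c , d) = (a ≟ c ×-dec b ≟ d) ⊎-dec (a ≟ d ×-dec b ≟ c)

pairSetoid : ℕ → Setoid 0ℓ 0ℓ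
pairSetoid n = record { Carrier = Pair n ; _≈_ = SamePair ; isEquivalence = samePair-isEquivalence }

module _ {n : ℕ} where

  open Setoid (pairSetoid n) using (_≈_) renaming (sym to ≈-sym; trans to ≈-trans)
  open SetoidMembership (pairSetoid n) using (_∈_; _∉_)

  Adjacent : Fin n → Fin n → Set
  Adjacent i j = toℕ j ≡ suc (toℕ i)

  adjacent⇒< : ∀ {i j : Fin n} → Adjacent i j → i < j
  adjacent⇒< eq = ℕ.≤-reflexive (sym eq)

  adjacent⇒≢ : ∀ {i j : Fin n} → Adjacent i j → i ≢ j
  adjacent⇒≢ adj refl = <-irrefl refl (adjacent⇒< adj)

  nothing-between-adjacent : ∀ {i j k : Fin n} → Adjacent i j → i < k → k < j → ⊥
  nothing-between-adjacent {k = k} adj i<k k<j =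
    ℕ.<⇒≱ i<k (ℕ.s≤s⁻¹ (subst (suc (toℕ k) ℕ.≤_) adj k<j))

  swapPos-i : ∀ (i j : Fin n) → swapPos i j i ≡ j
  swapPos-i i j with i ≟ i
  ... | yes _   = refl
  ... | no i≢i = contradiction refl i≢i

  swapPos-j : ∀ {i j : Fin n} → i ≢ j → swapPos i j j ≡ i
  swapPos-j {i} {j} i≢j with j ≟ i
  ... | yes j≡i = contradiction (sym j≡i) i≢j
  ... | no _ with j ≟ j
  ...   | yes _   = refl
  ...   | no j≢j = contradiction refl j≢j

  swapPos-other : ∀ {i j k : Fin n} → k ≢ i → k ≢ j → swapPos i j k ≡ k
  swapPos-other {i} {j} {k} k≢i k≢j with k ≟ i
  ... | yes k≡i = contradiction k≡i k≢i
  ... | no _ with k ≟ j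
  ...   | yes k≡j = contradiction k≡j k≢j
  ...   | no _    = refl

  data Position (i j k : Fin n) : Set where
    at-i      : k ≡ i → Position i j k
    at-j      : k ≡ j → Position i j k
    elsewhere : k ≢ i → k ≢ j → Position i j k

  position : ∀ i j k → Position i j k
  position i j k with k ≟ i | k ≟ j
  ... | yes k≡i | _       = at-i k≡i
  ... | no _    | yes k≡j = at-j k≡j
  ... | no k≢i  | no k≢j  = elsewhere k≢i k≢j

  swapPos-involutive : ∀ {i j : Fin n} → i ≢ j → ∀ k → swapPos i j (swapPos i j k) ≡ k
  swapPos-involutive {i} {j} i≢j k with position i j k
  ... | at-i refl = trans (cong (swapPos i j) (swapPos-i i j)) (swapPos-j i≢j)
  ... | at-j refl = trans (cong (swapPos i j) (swapPos-j i≢j)) (swapPos-i i j)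
  ... | elsewhere k≢i k≢j = trans (cong (swapPos i j) (swapPos-other k≢i k≢j)) (swapPos-other k≢i k≢j)

  swapPos-monotone : ∀ {i j a b : Fin n} → Adjacent i j → a < b → ¬ (a ≡ i × b ≡ j) →
                     swapPos i j a < swapPos i j b
  swapPos-monotone {i} {j} {a} {b} adj a<b not-ij with position i j a | position i j b
  ... | at-i refl | at-i refl = contradiction a<b (<-irrefl refl)
  ... | at-i refl | at-j refl = contradiction (refl , refl) not-ij
  ... | at-i refl | elsewhere b≢i b≢j
    rewrite swapPos-i i j | swapPos-other b≢i b≢j = ≤∧≢⇒< (subst (ℕ._≤ toℕ b) (sym adj) a<b) (b≢j ∘ sym)
  ... | at-j refl | at-i refl = contradiction (adjacent⇒< adj) (<-asym a<b)
  ... | at-j refl | at-j refl = contradiction a<b (<-irrefl refl)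
  ... | at-j refl | elsewhere b≢i b≢j
    rewrite swapPos-j (adjacent⇒≢ adj) | swapPos-other b≢i b≢j = <-trans (adjacent⇒< adj) a<b
  ... | elsewhere a≢i a≢j | at-i refl
    rewrite swapPos-i i j | swapPos-other a≢i a≢j = <-trans a<b (adjacent⇒< adj)
  ... | elsewhere a≢i a≢j | at-j refl
    rewrite swapPos-j (adjacent⇒≢ adj) | swapPos-other a≢i a≢j =
      ≤∧≢⇒< (ℕ.s≤s⁻¹ (subst (suc (toℕ a) ℕ.≤_) adj a<b)) a≢i
  ... | elsewhere a≢i a≢j | elsewhere b≢i b≢j
    rewrite swapPos-other a≢i a≢j | swapPos-other b≢i b≢j = a<b

  Inverses : (Fin n → Fin n) → (Fin n → Fin n) → Set
  Inverses σ ρ = StrictlyInverseˡ _≡_ σ ρ × StrictlyInverseʳ _≡_ σ ρ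

  Before : (Fin n → Fin n) → Fin n → Fin n → Set
  Before ρ x y = ρ x < ρ y

  inner-pairs-differ : ∀ {ρ p m q} → Before ρ p m → Before ρ m q → ¬ (m , q) ≈ (p , m)
  inner-pairs-differ p<m _   (inj₁ (refl , _)) = <-irrefl refl p<m
  inner-pairs-differ p<m m<q (inj₂ (_ , refl)) = <-irrefl refl (<-trans p<m m<q)

  module _ {σ ρ : Fin n → Fin n} (inv : Inverses σ ρ) {i j : Fin n} (adj : Adjacent i j) where

    inverses-swap : Inverses (σ ∘ swapPos i j) (swapPos i j ∘ ρ)
    inverses-swap =
      (λ x → trans (cong σ (swapPos-involutive (adjacent⇒≢ adj) (ρ x))) (proj₁ inv x)) ,
      (λ k → trans (cong (swapPos i j) (proj₂ inv (swapPos i j k))) (swapPos-involutive (adjacent⇒≢ adj) k))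

    crossing-positions : ∀ {x y} → Before ρ x y → (x , y) ≈ (σ i , σ j) → ρ x ≡ i × ρ y ≡ j
    crossing-positions _ (inj₁ (refl , refl)) = proj₂ inv i , proj₂ inv j
    crossing-positions x<y (inj₂ (refl , refl)) =
      contradiction (adjacent⇒< adj) (<-asym (subst₂ _<_ (proj₂ inv j) (proj₂ inv i) x<y))

    before-preserved : ∀ {x y} → Before ρ x y → ¬ (x , y) ≈ (σ i , σ j) → Before (swapPos i j ∘ ρ) x y
    before-preserved {x} {y} x<y not-crossing = swapPos-monotone adj x<y λ where
      (ρx≡i , ρy≡j) → not-crossing (inj₁ (trans (sym (proj₁ inv x)) (cong σ ρx≡i) ,
                                          trans (sym (proj₁ inv y)) (cong σ ρy≡j)))

    before-flipped : ∀ {x y} → Before ρ x y → (x , y) ≈ (σ i , σ j) → Before (swapPos i j ∘ ρ) y x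
    before-flipped x<y crossing with crossing-positions x<y crossing
    ... | ρx≡i , ρy≡j rewrite ρx≡i | ρy≡j | swapPos-i i j | swapPos-j (adjacent⇒≢ adj) = adjacent⇒< adj

    crossing-not-over : ∀ {p m q} → Before ρ p m → Before ρ m q → ¬ (p , q) ≈ (σ i , σ j)
    crossing-not-over {m = m} p<m m<q crossing with crossing-positions (<-trans p<m m<q) crossing
    ... | refl , refl = nothing-between-adjacent {k = ρ m} adj p<m m<q

  module _ (G : TemporalClique n) where

    labelOf : Pair n → ℕ
    labelOf e = lab G (proj₁ e) (proj₂ e)

    _≺_ : Pair n → Pair n → Set
    e ≺ f = labelOf e ℕ.< labelOf f

    labelOf-resp : ∀ {e f} → e ≈ f → labelOf e ≡ labelOf f
    labelOf-resp (inj₁ (refl , refl)) = refl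
    labelOf-resp {u , v} (inj₂ (refl , refl)) = lab-sym G u v

    ≺-respʳ : ∀ {e f g} → f ≈ g → e ≺ f → e ≺ g
    ≺-respʳ {e} f≈g = subst (labelOf e ℕ.<_) (labelOf-resp f≈g)

    ≺-respˡ : ∀ {e f g} → e ≈ f → e ≺ g → f ≺ g
    ≺-respˡ {g = g} e≈f = subst (ℕ._< labelOf g) (labelOf-resp e≈f)

    head-≺ : ∀ {h e f xs} → All (h ≺_) xs → e ≈ h → f ∈ xs → e ≺ f
    head-≺ h≺xs e≈h f∈xs = ≺-respˡ (≈-sym e≈h) (lookupₛ (pairSetoid n) ≺-respʳ h≺xs f∈xs)

    head-∉ : ∀ {h e xs} → All (h ≺_) xs → e ≈ h → e ∉ xs
    head-∉ h≺xs e≈h e∈xs = ℕ.<-irrefl refl (head-≺ h≺xs e≈h e∈xs)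

    CrossedInOrder : List (Pair n) → Pair n → Pair n → Pair n → Set
    CrossedInOrder xs e f g = e ∈ xs × e ≺ f × (g ∈ xs → f ≺ g)

    crossedInOrder-∷ : ∀ {h xs e f g} → ¬ g ≈ h → CrossedInOrder xs e f g → CrossedInOrder (h ∷ xs) e f g
    crossedInOrder-∷ g≉h (e∈xs , e≺f , f≺g) = there e∈xs , e≺f , f≺g ∘ tail g≉h

    CrossingOrder : List (Pair n) → Fin n → Fin n → Fin n → Set
    CrossingOrder xs p m q = CrossedInOrder xs (p , m) (p , q) (m , q) ⊎ CrossedInOrder xs (m , q) (p , q) (p , m)

    -- If the head crossing is an inner pair, the triple is reordered and the other inner pair
    -- becomes the outer one; as no pair crosses twice, the recursive call orders the rest.
    crossing-order : ∀ {σ ρ xs p m q} → Schedule σ xs → Inverses σ ρ → AllPairs _≺_ xs →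
      Before ρ p m → Before ρ m q → (p , q) ∈ xs → CrossingOrder xs p m q
    crossing-order done _ _ _ _ ()
    crossing-order {σ = σ} {ρ} {p = p} {m} {q}
      (cross {p = h} {xs = xs} i j adj h≈ij rest) inv (h≺xs ∷ increasing) p<m m<q pq∈ =
      by-head (samePair? (p , q) h) (samePair? (p , m) h) (samePair? (m , q) h)
      where
      swap-pair : ∀ {x y} → (x , y) ≈ (y , x)
      swap-pair = inj₂ (refl , refl)

      not-crossing : ∀ {e} → ¬ e ≈ h → ¬ e ≈ (σ i , σ j)
      not-crossing e≉h e≈ij = e≉h (≈-trans e≈ij (≈-sym h≈ij))

      later : ∀ {p′ m′ q′} → Before (swapPos i j ∘ ρ) p′ m′ → Before (swapPos i j ∘ ρ) m′ q′ →
              (p′ , q′) ∈ xs → CrossingOrder xs p′ m′ q′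
      later = crossing-order rest (inverses-swap {σ} {ρ} inv adj) increasing

      by-head : Dec ((p , q) ≈ h) → Dec ((p , m) ≈ h) → Dec ((m , q) ≈ h) → CrossingOrder (h ∷ xs) p m q
      by-head (yes pq≈h) _ _ = contradiction (≈-trans pq≈h h≈ij) (crossing-not-over inv adj p<m m<q)
      by-head (no pq≉h) (yes pm≈h) _ =
        inj₁ (here pm≈h , head-≺ h≺xs pm≈h pq∈xs ,
              λ mq∈ → pq-before-mq (later (before-flipped inv adj p<m (≈-trans pm≈h h≈ij))
                                         (before-preserved inv adj (<-trans p<m m<q) (not-crossing pq≉h))
                                         (tail mq≉h mq∈)))
        where
        pq∈xs : (p , q) ∈ xs
        pq∈xs = tail pq≉h pq∈
        mq≉h : ¬ (m , q) ≈ h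
        mq≉h mq≈h = inner-pairs-differ p<m m<q (≈-trans mq≈h (≈-sym pm≈h))
        pq-before-mq : CrossingOrder xs m p q → (p , q) ≺ (m , q)
        pq-before-mq (inj₁ (mp∈xs , _)) = contradiction mp∈xs (head-∉ h≺xs (≈-trans swap-pair pm≈h))
        pq-before-mq (inj₂ (_ , pq≺mq , _)) = pq≺mq
      by-head (no pq≉h) (no pm≉h) (yes mq≈h) =
        inj₂ (here mq≈h , head-≺ h≺xs mq≈h pq∈xs ,
              λ pm∈ → pq-before-pm (later (before-preserved inv adj (<-trans p<m m<q) (not-crossing pq≉h))
                                         (before-flipped inv adj m<q (≈-trans mq≈h h≈ij))
                                         (tail pm≉h pm∈)))
        where
        pq∈xs : (p , q) ∈ xs
        pq∈xs = tail pq≉h pq∈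
        pq-before-pm : CrossingOrder xs p q m → (p , q) ≺ (p , m)
        pq-before-pm (inj₁ (_ , pq≺pm , _)) = pq≺pm
        pq-before-pm (inj₂ (qm∈xs , _)) = contradiction qm∈xs (head-∉ h≺xs (≈-trans swap-pair mq≈h))
      by-head (no pq≉h) (no pm≉h) (no mq≉h) =
        Sum.map (crossedInOrder-∷ mq≉h) (crossedInOrder-∷ pm≉h)
          (later (before-preserved inv adj p<m (not-crossing pm≉h))
                 (before-preserved inv adj m<q (not-crossing mq≉h))
                 (tail pq≉h pq∈))

    Straddles : Fin n → Fin n → Fin n → Set
    Straddles a b x = (lab G x a ℕ.< lab G a b × lab G a b ℕ.< lab G x b)
                    ⊎ (lab G x b ℕ.< lab G a b × lab G a b ℕ.< lab G x a)

    straddles-sym : ∀ {a b x} → Straddles a b x → Straddles b a x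
    straddles-sym {a} {b} straddles rewrite lab-sym G b a = Sum.swap straddles

    between-straddles : ∀ {σ ρ xs a x b} → Schedule σ xs → Inverses σ ρ → AllPairs _≺_ xs →
      (∀ u v → u ≢ v → (u , v) ∈ xs) → Before ρ a x → Before ρ x b → Straddles a b x
    between-straddles {ρ = ρ} {a = a} {x} {b} schedule inv increasing complete a<x x<b
      with crossing-order schedule inv increasing a<x x<b (complete a b (<⇒≢ (<-trans a<x x<b) ∘ cong ρ))
    ... | inj₁ (_ , ax≺ab , ab≺xb) rewrite lab-sym G x a = inj₁ (ax≺ab , ab≺xb (complete x b (<⇒≢ x<b ∘ cong ρ)))
    ... | inj₂ (_ , xb≺ab , ab≺ax) rewrite lab-sym G x a = inj₂ (xb≺ab , ab≺ax (complete a x (<⇒≢ a<x ∘ cong ρ)))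

    module _ {Hub : Fin n → Set} where

      HubEdge : Fin n → Fin n → Set
      HubEdge u w = Hub u ⊎ Hub w

      path-via-hub : ∀ {a b u w} → Hub a → Hub b → a ≢ b → u ≢ a → w ≢ a → w ≢ b →
        lab G u a ℕ.< lab G a b → Straddles a b w → TPath G HubEdge 0 u w
      path-via-hub {a} {b} {u} {w} hub-a hub-b a≢b u≢a w≢a w≢b ua<ab (inj₁ (_ , ab<wb))
        rewrite lab-sym G w b =
        step u≢a (inj₂ hub-a) z≤n (step a≢b (inj₁ hub-a) ua<ab (edge (w≢b ∘ sym) (inj₁ hub-b) ab<wb))
      path-via-hub {a} {b} {u} {w} hub-a _ _ u≢a w≢a _ ua<ab (inj₂ (_ , ab<wa))
        rewrite lab-sym G w a =
        step u≢a (inj₂ hub-a) z≤n (edge (w≢a ∘ sym) (inj₁ hub-a) (ℕ.<-trans ua<ab ab<wa))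

      two-hub-spanner : ∀ {a b} → Hub a → Hub b → a ≢ b →
        (∀ x → x ≢ a → x ≢ b → Straddles a b x) → IsTemporalSpanner G HubEdge
      two-hub-spanner {a} {b} hub-a hub-b a≢b straddles u w u≢w with u ≟ a | u ≟ b | w ≟ a | w ≟ b
      ... | yes refl | _        | _        | _        = edge u≢w (inj₁ hub-a) z≤n
      ... | no _     | yes refl | _        | _        = edge u≢w (inj₁ hub-b) z≤n
      ... | no _     | no _     | yes refl | _        = edge u≢w (inj₂ hub-a) z≤n
      ... | no _     | no _     | no _     | yes refl = edge u≢w (inj₂ hub-b) z≤n
      ... | no u≢a   | no u≢b   | no w≢a   | no w≢b with straddles u u≢a u≢b
      ...   | inj₁ (ua<ab , _) =
              path-via-hub hub-a hub-b a≢b u≢a w≢a w≢b ua<ab (straddles w w≢a w≢b)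
      ...   | inj₂ (ub<ab , _) =
              path-via-hub hub-b hub-a (a≢b ∘ sym) u≢b w≢b w≢a (subst (lab G u b ℕ.<_) (lab-sym G a b) ub<ab)
                (straddles-sym (straddles w w≢a w≢b))

module _ {n : ℕ} (π : Permutation′ n) where

  permutation-inverses : Inverses (π ⟨$⟩ʳ_) (π ⟨$⟩ˡ_)
  permutation-inverses = (λ _ → inverseʳ π) , (λ _ → inverseˡ π)

  ⟨$⟩ʳ-injective : ∀ {i j} → π ⟨$⟩ʳ i ≡ π ⟨$⟩ʳ j → i ≡ j
  ⟨$⟩ʳ-injective e = trans (sym (inverseˡ π)) (trans (cong (π ⟨$⟩ˡ_) e) (inverseˡ π))

  ⟨$⟩ˡ-≢ : ∀ {x i} → x ≢ π ⟨$⟩ʳ i → π ⟨$⟩ˡ x ≢ i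
  ⟨$⟩ˡ-≢ x≢πi e = x≢πi (trans (sym (inverseʳ π)) (cong (π ⟨$⟩ʳ_) e))

module _ {n : ℕ} (π : Permutation′ (suc n)) where

  first-before : ∀ {x} → x ≢ π ⟨$⟩ʳ zero → Before (π ⟨$⟩ˡ_) (π ⟨$⟩ʳ zero) x
  first-before x≢first rewrite inverseˡ π {zero} = ≤∧≢⇒< z≤n (⟨$⟩ˡ-≢ π x≢first ∘ sym)

  before-last : ∀ {x} → x ≢ π ⟨$⟩ʳ fromℕ n → Before (π ⟨$⟩ˡ_) x (π ⟨$⟩ʳ fromℕ n)
  before-last x≢last rewrite inverseˡ π {fromℕ n} = ≤∧≢⇒< (≤fromℕ _) (⟨$⟩ˡ-≢ π x≢last)

mainTheorem9 : (n : ℕ) → 2 ≤ n → (G : TemporalClique n) →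
    OneDMobilityClique G → (π : Permutation′ n) → RepIsScheduleFrom G π →
    IsTemporalSpanner G (HEdge π)
mainTheorem9 (suc (suc k)) (s≤s (s≤s _)) G _ π (xs , (_ , increasing , complete) , schedule) =
  two-hub-spanner G first-endpoint last-endpoint (0≢1+n ∘ ⟨$⟩ʳ-injective π) λ x x≢first x≢last →
    between-straddles G schedule (permutation-inverses π) (Linked⇒AllPairs ℕ.<-trans increasing) complete
      (first-before π x≢first) (before-last π x≢last)
  where
  first-endpoint : IsEndpoint π (π ⟨$⟩ʳ zero)
  first-endpoint = zero , inj₁ refl , refl

  last-endpoint : IsEndpoint π (π ⟨$⟩ʳ fromℕ (suc k))
  last-endpoint = fromℕ (suc k) , inj₂ (cong suc (toℕ-fromℕ (suc k))) , refl
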